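{- Let $b\ge1$ and $g=4b^2$. Let $D$ be a digraph of directed girth at least $g$, and assume that for every arc $(x,y)\in A(D)$, either $D$ contains a directed cycle of length exactly $g$ through $(x,y)$, or there is $z\in V(D)\setminus\{x,y\}$ with $(z,x),(z,y)\in A(D)$. Then for every $(p,q)\in A(D)$ there is a gadget $G\subseteq D$ which is of type I or an extended gadget of type II, with $p(G)=p$, $q(G)=q$ and $|V(G)|\le 2g$.
   Context: Digraphs are finite, loopless, without parallel arcs. Directed girth is the minimum length of a directed cycle. Gadgets with designated vertices $p=p(G)$, $q=q(G)$: type I is a directed cycle of length at least $g$ through the arc $(p,q)$. A basic type-II gadget consists of vertices $p,q,r$, a directed path $P_1$ from $r$ to $p$ of length at least $2b^2+b-2$ with $q\notin V(P_1)$, and an arc from every vertex of $P_1$ to $q$. An extended type-II gadget is a basic one together with a directed path $P_2$ of length at least $b$ whose last vertex is $r$, with $V(P_1)\cap V(P_2)=\{r\}$, $q\notin V(P_2)$, and either an arc from the first vertex of $P_2$ to the second vertex of $P_1$, or an arc from some vertex of $V(P_1)\setminus\{r\}$ to the first vertex of $P_2$. -}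

module Defs where

open import Data.Nat using (ℕ; _+_; _*_; _∸_; _≤_)
open import Data.Bool using (Bool; T; false)
open import Data.Fin using (Fin)
open import Data.Fin.Properties using (_≟_)
open import Data.List using (List; []; _∷_; length; head; last; deduplicate; _++_)
open import Data.List.Relation.Unary.Linked using (Linked)
open import Data.List.Relation.Unary.All using (All)
open import Data.List.Relation.Unary.Unique.Propositional using (Unique)
open import Data.List.Membership.Propositional using (_∈_; _∉_)
open import Data.Maybe using (just)
open import Data.Empty using (⊥)
open import Data.Product using (Σ; ∃; ∃-syntax; _×_)
open import Data.Sum using (_⊎_)
open import Relation.Binary.PropositionalEquality using (_≡_; _≢_)

-- A finite digraph: vertex set Fin n, arc relation given by a Boolean
-- adjacency function (so no parallel arcs), loopless.
record Digraph : Set where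
  field
    n       : ℕ
    arc     : Fin n → Fin n → Bool
    loopless : ∀ x → arc x x ≡ false

module _ (D : Digraph) where
  open Digraph D

  V : Set
  V = Fin n

  Arc : V → V → Set
  Arc x y = T (arc x y)

  -- xs is (the vertex sequence of) a directed path: distinct vertices,
  -- consecutive ones joined by arcs. Its length is  length xs ∸ 1.
  IsDirPath : List V → Set
  IsDirPath xs = Unique xs × Linked Arc xs

  pathLength : List V → ℕ
  pathLength xs = length xs ∸ 1

  -- x ∷ xs is a directed cycle v₀ v₁ … v_{k-1} (arcs vᵢ → vᵢ₊₁ and
  -- v_{k-1} → v₀); its length is k = number of vertices.
  IsDirCycle : List V → Set
  IsDirCycle [] = ⊥
  IsDirCycle (x ∷ xs) = Unique (x ∷ xs) × Linked Arc (x ∷ xs) × Σ V (λ l → last (x ∷ xs) ≡ just l × Arc l x)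

  GirthAtLeast : ℕ → Set
  GirthAtLeast g = ∀ (cs : List V) → IsDirCycle cs → g ≤ length cs

  -- a directed cycle through the arc (x , y), of length k: written starting
  -- with the arc, i.e. as x y v₂ … v_{k-1}
  CycleThrough : V → V → (List V → Set) → Set
  CycleThrough x y P = ∃[ rest ] (IsDirCycle (x ∷ y ∷ rest) × P (x ∷ y ∷ rest))

  -- Type I gadget G ⊆ D with p(G)=p, q(G)=q, |V(G)| ≤ m:
  -- a directed cycle of length ≥ g through (p , q) with at most m vertices.
  TypeIGadget : (g : ℕ) → V → V → (m : ℕ) → Set
  TypeIGadget g p q m = CycleThrough p q (λ cs → g ≤ length cs × length cs ≤ m)

  -- Extended type-II gadget G ⊆ D (parameter b) with p(G)=p, q(G)=q and
  -- |V(G)| ≤ m, where V(G) = {q} ∪ V(P₁) ∪ V(P₂).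
  ExtTypeIIGadget : (b : ℕ) → V → V → (m : ℕ) → Set
  ExtTypeIIGadget b p q m =
    Σ V λ r → Σ (List V) λ P₁ → Σ (List V) λ P₂ →
      IsDirPath P₁ × head P₁ ≡ just r × last P₁ ≡ just p ×
      2 * b * b + b ∸ 2 ≤ pathLength P₁ × q ∉ P₁ ×
      All (λ v → Arc v q) P₁ ×
      IsDirPath P₂ × last P₂ ≡ just r × b ≤ pathLength P₂ ×
      (∀ v → v ∈ P₁ → v ∈ P₂ → v ≡ r) × q ∉ P₂ ×
      ( (∃[ w ] ∃[ s ] ∃[ rest ] (head P₂ ≡ just w × P₁ ≡ r ∷ s ∷ rest × Arc w s))
      ⊎ (∃[ w ] ∃[ v ] (head P₂ ≡ just w × v ∈ P₁ × v ≢ r × Arc v w)) ) ×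
      length (deduplicate _≟_ (q ∷ P₁ ++ P₂)) ≤ m

module Submission where

-- Write g for the girth bound and N = 2b²+b-2.  Starting from the arc
-- (p , q) we walk backwards along common in-neighbours: while the current
-- head x of the chain has no g-cycle through (x , q), the hypothesis gives
-- z with z → x and z → q, and z becomes the new head.  Either this chain
-- reaches length N, giving the path P₁ of a basic type-II gadget (all its
-- vertices dominate q), or a g-cycle through (x , q) closes a short walk
-- q ⇝ p, which shortcuts to a type-I cycle.  In the first case we grow a
-- second chain of length b ending at r, whose vertices dominate the second
-- vertex s of P₁: if it completes it is P₂; otherwise a g-cycle yields a
-- walk s ⇝ r, and the last vertex of that walk lying in {q} ∪ V(P₁) - {r}
-- either closes a type-I cycle (if it is q) or attaches a path P₂ by an
-- arc from P₁ (large girth forces this P₂ to have length at least b).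

open import Defs
open import Data.Nat using (ℕ; _*_; _≤_)
open import Data.List using (length)
open import Data.Product using (∃-syntax; _×_)
open import Data.Sum using (_⊎_)
open import Relation.Binary.PropositionalEquality using (_≡_; _≢_)

open import Data.Nat using (zero; suc; _+_; _∸_; _<_; z≤n; s≤s; s≤s⁻¹)
open import Data.Nat.Properties
  using (≤-refl; ≤-reflexive; ≤-trans; <⇒≤; <-≤-trans; <-irrefl; n≤1+n; m<n⇒m<1+n; n<1+n;
         m≤m+n; m≤n+m; +-mono-≤; +-monoˡ-≤; +-monoʳ-≤; +-cancelˡ-≤; +-comm; +-suc; +-identityʳ;
         module ≤-Reasoning)
open import Data.Nat.Tactic.RingSolver using (solve-∀)
open import Data.Bool using (T)
open import Data.Fin.Properties using (_≟_)
open import Data.List using (List; []; _∷_; _++_; _∷ʳ_; last; deduplicate; initLast; _∷ʳ′_)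
open import Data.List.Properties using (length-++; length-deduplicate)
open import Data.List.Relation.Unary.Linked as Linked using (Linked; [-]; _∷_)
open import Data.List.Relation.Unary.All as All using (All; []; _∷_)
open import Data.List.Relation.Unary.All.Properties using (¬Any⇒All¬; ++⁻ˡ; ++⁻ʳ)
open import Data.List.Relation.Unary.AllPairs using ([]; _∷_)
open import Data.List.Relation.Unary.Any using (here; there)
open import Data.List.Relation.Unary.Unique.Propositional using (Unique)
open import Data.List.Membership.Propositional using (_∈_; _∉_)
open import Data.List.Membership.Propositional.Properties using (∈-∃++; ∈-++⁺ˡ; ∈-++⁺ʳ)
open import Data.Maybe using (just)
open import Data.Maybe.Properties using (just-injective)
open import Data.Empty using (⊥-elim)
open import Data.Product using (_,_; proj₁; proj₂)
open import Data.Sum using (inj₁; inj₂)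
open import Relation.Nullary using (¬_; Dec; yes; no)
open import Relation.Nullary.Decidable using (_⊎-dec_)
open import Relation.Binary.Definitions using (DecidableEquality)
open import Relation.Binary.PropositionalEquality using (refl; sym; trans; cong; cong₂; subst; module ≡-Reasoning)

-- Walks as vertex lists.  A walk is a nonempty list x ∷ xs whose consecutive
-- entries are related; it has (length xs) arcs and runs from x to end x xs.

module _ {A : Set} where

  end : A → List A → A
  end x []       = x
  end x (y ∷ ys) = end y ys

  last≡end : ∀ x xs → last (x ∷ xs) ≡ just (end x xs)
  last≡end x []       = refl
  last≡end x (y ∷ ys) = last≡end y ys

  end-++ : ∀ x xs ys → end x (xs ++ ys) ≡ end (end x xs) ys
  end-++ x []       ys = refl
  end-++ x (y ∷ xs) ys = end-++ y xs ys

  end-split : ∀ x xs as y bs → x ∷ xs ≡ as ++ y ∷ bs → end x xs ≡ end y bs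
  end-split x xs []       y bs refl = refl
  end-split x xs (a ∷ as) y bs refl = end-++ a as (y ∷ bs)

  length-split : ∀ (as : List A) y bs → length (as ++ y ∷ bs) ≡ suc (length as + length bs)
  length-split as y bs = trans (length-++ as) (+-suc (length as) (length bs))

  length-∷ʳ : ∀ (as : List A) y → length (as ∷ʳ y) ≡ suc (length as)
  length-∷ʳ as y = trans (length-++ as) (+-comm (length as) 1)

  unique-prefix : ∀ (as : List A) {bs} → Unique (as ++ bs) → Unique as
  unique-prefix []       u         = []
  unique-prefix (a ∷ as) (a∉ ∷ u) = ++⁻ˡ as a∉ ∷ unique-prefix as u

  unique-suffix : ∀ (as : List A) {bs} → Unique (as ++ bs) → Unique bs
  unique-suffix []       u       = u
  unique-suffix (a ∷ as) (_ ∷ u) = unique-suffix as u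

  unique-disjoint : ∀ (as : List A) {bs x} → Unique (as ++ bs) → x ∈ as → x ∉ bs
  unique-disjoint (a ∷ as) (a∉ ∷ u) (here refl) x∈bs = All.lookup (++⁻ʳ as a∉) x∈bs refl
  unique-disjoint (a ∷ as) (_ ∷ u)  (there x∈as) x∈bs = unique-disjoint as u x∈as x∈bs

module _ {A : Set} {R : A → A → Set} where

  linked-++ : ∀ {x} xs {ys} → Linked R (x ∷ xs) → Linked R (end x xs ∷ ys) → Linked R (x ∷ xs ++ ys)
  linked-++ []       _          l₂ = l₂
  linked-++ (y ∷ ys) (xy ∷ l₁) l₂ = xy ∷ linked-++ ys l₁ l₂

  linked-prefix : ∀ {x} xs {z ys} → Linked R (x ∷ xs ++ z ∷ ys) → Linked R (x ∷ xs) × R (end x xs) z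
  linked-prefix []       (xz ∷ _) = [-] , xz
  linked-prefix (y ∷ ys) (xy ∷ l) = xy ∷ proj₁ (linked-prefix ys l) , proj₂ (linked-prefix ys l)

  linked-suffix : ∀ xs {ys} → Linked R (xs ++ ys) → Linked R ys
  linked-suffix []       l = l
  linked-suffix (x ∷ xs) l = linked-suffix xs (Linked.tail l)

-- Every walk can be shortcut to a path with the same ends, using only
-- vertices of the walk and no more arcs: cut out the closed subwalk
-- between two visits of a vertex.

module Shortcut {A : Set} (_≟ᴬ_ : DecidableEquality A) (R : A → A → Set) where

  open import Data.List.Membership.DecPropositional _≟ᴬ_ using (_∈?_)

  record PathIn (x : A) (xs : List A) : Set where
    field
      vertices  : List A
      unique    : Unique (x ∷ vertices)
      linked    : Linked R (x ∷ vertices)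
      same-end  : end x vertices ≡ end x xs
      sub       : ∀ {v} → v ∈ x ∷ vertices → v ∈ x ∷ xs
      shorter   : length vertices ≤ length xs

  -- Prepending an arc x → y to a path from y: either x is new, or the
  -- path already passes through x and we keep its part after x.
  prepend : ∀ {x y ys} → R x y → PathIn y ys → PathIn x (y ∷ ys)
  prepend {x} {y} {ys} xy π with x ∈? (y ∷ PathIn.vertices π)
  ... | no x∉ = record
    { vertices = y ∷ vertices ; unique = ¬Any⇒All¬ _ x∉ ∷ unique ; linked = xy ∷ linked
    ; same-end = same-end ; sub = λ { (here e) → here e ; (there v∈) → there (sub v∈) }
    ; shorter = s≤s shorter }
    where open PathIn π
  ... | yes x∈ with ∈-∃++ x∈
  ...   | as , bs , split = record
    { vertices = bs
    ; unique   = unique-suffix as (subst Unique split unique)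
    ; linked   = linked-suffix as (subst (Linked R) split linked)
    ; same-end = trans (sym (end-split y vertices as x bs split)) same-end
    ; sub      = λ v∈ → there (sub (subst (_ ∈_) (sym split) (∈-++⁺ʳ as v∈)))
    ; shorter  = ≤-trans (n≤1+n _) (s≤s (≤-trans bs≤ shorter)) }
    where
      open PathIn π
      bs≤ : length bs ≤ length vertices
      bs≤ = s≤s⁻¹ (≤-trans (s≤s (m≤n+m (length bs) (length as)))
                    (≤-reflexive (trans (sym (length-split as x bs)) (cong length (sym split)))))

  shortcut : ∀ x xs → Linked R (x ∷ xs) → PathIn x xs
  shortcut x []       _        = record
    { vertices = [] ; unique = [] ∷ [] ; linked = [-] ; same-end = refl ; sub = λ v∈ → v∈ ; shorter = z≤n }
  shortcut x (y ∷ ys) (xy ∷ l) = prepend xy (shortcut y ys l)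

module LastExit {A : Set} {R : A → A → Set} (S : A → Set) (S? : ∀ v → Dec (S v)) where

  record Exit (x₀ : A) (xs₀ : List A) : Set where
    constructor exit
    field
      y c   : A
      rest  : List A
      in-S  : S y
      arc   : R y c
      walk  : Linked R (c ∷ rest)
      ends  : end c rest ≡ end x₀ xs₀
      avoid : All (λ v → ¬ S v) (c ∷ rest)
      short : length rest < length xs₀

  private
    scan : ∀ x xs → Linked R (x ∷ xs) → ¬ S (end x xs) → All (λ v → ¬ S v) (x ∷ xs) ⊎ Exit x xs
    scan x []       _        ∉S = inj₁ (∉S ∷ [])
    scan x (d ∷ ds) (xd ∷ l) ∉S with scan d ds l ∉S
    ... | inj₂ e = inj₂ (record { Exit e ; short = m<n⇒m<1+n (Exit.short e) })
    ... | inj₁ avoid with S? x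
    ...   | yes x∈S = inj₂ (record { y = x ; c = d ; rest = ds ; in-S = x∈S ; arc = xd ; walk = l
                                   ; ends = refl ; avoid = avoid ; short = n<1+n _ })
    ...   | no x∉S = inj₁ (x∉S ∷ avoid)

  lastExit : ∀ x xs → Linked R (x ∷ xs) → S x → ¬ S (end x xs) → Exit x xs
  lastExit x xs l x∈S ∉S with scan x xs l ∉S
  ... | inj₁ avoid = ⊥-elim (All.head avoid x∈S)
  ... | inj₂ e     = e

module Girth (D : Digraph) (g : ℕ) (girth : GirthAtLeast D g) where

  open Shortcut (_≟_ {Digraph.n D}) (Arc D)

  closed-walk-long : ∀ x xs → Linked (Arc D) (x ∷ xs) → Arc D (end x xs) x → g ≤ suc (length xs)
  closed-walk-long x xs l back = ≤-trans (girth (x ∷ vertices) cycle) (s≤s shorter)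
    where
      open PathIn (shortcut x xs l)
      cycle : IsDirCycle D (x ∷ vertices)
      cycle = unique , linked , end x vertices , last≡end x vertices ,
              subst (λ v → Arc D v x) (sym same-end) back

  -- A walk with fewer than g arcs is a path: a repeated vertex would close
  -- a shorter closed walk.
  short-walk-unique : ∀ x xs → length xs < g → Linked (Arc D) (x ∷ xs) → Unique (x ∷ xs)
  short-walk-unique x []       _  _        = [] ∷ []
  short-walk-unique x (y ∷ ys) lt (xy ∷ l) =
    ¬Any⇒All¬ _ x∉ ∷ short-walk-unique y ys (≤-trans (n≤1+n _) lt) l
    where
      x∉ : x ∉ y ∷ ys
      x∉ x∈ with ∈-∃++ x∈
      ... | as , bs , split =
        <-irrefl refl (<-≤-trans lt (≤-trans (closed-walk-long x as (proj₁ before-x) (proj₂ before-x)) as<))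
        where
          before-x : Linked (Arc D) (x ∷ as) × Arc D (end x as) x
          before-x = linked-prefix as (subst (λ L → Linked (Arc D) (x ∷ L)) split (xy ∷ l))
          as< : suc (length as) ≤ length (y ∷ ys)
          as< = ≤-trans (s≤s (m≤m+n (length as) (length bs)))
                        (≤-reflexive (trans (sym (length-split as x bs)) (cong length (sym split))))

  typeI-from-path : ∀ {p q m} → Arc D p q → ∀ ys → Unique (q ∷ ys) → Linked (Arc D) (q ∷ ys) →
                    end q ys ≡ p → suc (length ys) ≤ m → TypeIGadget D g p q m
  typeI-from-path {p} {q} pq ys u l e bound with initLast ys
  ... | [] = ⊥-elim (subst T (Digraph.loopless D q) (subst (λ v → Arc D v q) (sym e) pq))
  ... | zs ∷ʳ′ z = zs , cycle , girth (p ∷ q ∷ zs) cycle ,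
                   ≤-trans (≤-reflexive (cong suc (sym (length-∷ʳ zs z)))) bound
    where
      z≡p : z ≡ p
      z≡p = trans (sym (end-++ q zs (z ∷ []))) e
      before-z : Linked (Arc D) (q ∷ zs) × Arc D (end q zs) z
      before-z = linked-prefix zs l
      cycle : IsDirCycle D (p ∷ q ∷ zs)
      cycle = (¬Any⇒All¬ _ (λ p∈ → unique-disjoint (q ∷ zs) u p∈ (here (sym z≡p))) ∷ unique-prefix (q ∷ zs) u) ,
              pq ∷ proj₁ before-z , end q zs , last≡end q zs , subst (Arc D (end q zs)) z≡p (proj₂ before-z)

  typeI-from-walk : ∀ {p q m} → Arc D p q → ∀ ws → Linked (Arc D) (q ∷ ws) →
                    end q ws ≡ p → suc (length ws) ≤ m → TypeIGadget D g p q m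
  typeI-from-walk {q = q} pq ws l e bound =
    typeI-from-path pq vertices unique linked (trans same-end e) (≤-trans (s≤s shorter) bound)
    where open PathIn (shortcut q ws l)

CycleOrCommonInNeighbour : Digraph → ℕ → Set
CycleOrCommonInNeighbour D g = ∀ x y → Arc D x y →
  CycleThrough D x y (λ cs → length cs ≡ g) ⊎ (∃[ z ] (z ≢ x × z ≢ y × Arc D z x × Arc D z y))

module Chains (D : Digraph) (g : ℕ) (hyp : CycleOrCommonInNeighbour D g) where

  record Dominating (y x₀ x : V D) (xs : List (V D)) : Set where
    constructor dominating
    field
      walk : Linked (Arc D) (x ∷ xs)
      ends : end x xs ≡ x₀
      into : All (λ v → Arc D v y) (x ∷ xs)

  -- The outcome of growing such a walk to k arcs: it either succeeds, or a
  -- g-cycle through (x , y) at the current head x returns from y to x₀.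
  data Chain (y x₀ : V D) (k : ℕ) : Set where
    complete : ∀ x xs → Dominating y x₀ x xs → length xs ≡ k → Chain y x₀ k
    returns  : ∀ ws → Linked (Arc D) (y ∷ ws) → end y ws ≡ x₀ → suc (suc (length ws)) ≤ g + k → Chain y x₀ k

  around : ∀ {x y x₀ rest xs} → IsDirCycle D (x ∷ y ∷ rest) → Linked (Arc D) (x ∷ xs) → end x xs ≡ x₀ →
           Linked (Arc D) (y ∷ rest ++ x ∷ xs) × end y (rest ++ x ∷ xs) ≡ x₀
  around {x} {y} {rest = rest} {xs} (_ , _ ∷ l , v , last≡v , vx) lx e =
    linked-++ rest l (back ∷ lx) , trans (end-++ y rest (x ∷ xs)) e
    where
      back : Arc D (end y rest) x
      back = subst (λ u → Arc D u x) (just-injective (trans (sym last≡v) (last≡end y rest))) vx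

  chain : ∀ y x₀ → Arc D x₀ y → ∀ k → Chain y x₀ k
  chain y x₀ x₀y zero = complete x₀ [] (dominating [-] refl (x₀y ∷ [])) refl
  chain y x₀ x₀y (suc k) with chain y x₀ x₀y k
  ... | returns ws l e bound = returns ws l e (≤-trans bound (+-monoʳ-≤ g (n≤1+n k)))
  ... | complete x xs (dominating l e into) len with hyp x y (All.head into)
  ...   | inj₂ (z , _ , _ , zx , zy) = complete z (x ∷ xs) (dominating (zx ∷ l) e (zy ∷ into)) (cong suc len)
  ...   | inj₁ (rest , cycle , cycle-length) =
    returns (rest ++ x ∷ xs) (proj₁ (around cycle l e)) (proj₂ (around cycle l e)) (≤-reflexive length-eq)
    where
      open ≡-Reasoning
      shift : ∀ m n → suc (suc (suc (m + n))) ≡ suc (suc m) + suc n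
      shift = solve-∀
      length-eq : suc (suc (length (rest ++ x ∷ xs))) ≡ g + suc k
      length-eq = begin
        suc (suc (length (rest ++ x ∷ xs)))       ≡⟨ cong (λ t → suc (suc t)) (length-split rest x xs) ⟩
        suc (suc (suc (length rest + length xs))) ≡⟨ shift (length rest) (length xs) ⟩
        suc (suc (length rest)) + suc (length xs) ≡⟨ cong₂ _+_ cycle-length (cong suc len) ⟩
        g + suc k                                 ∎

module Bounds (b N g : ℕ) (room : b + N + 2 ≤ g) where

  open ≤-Reasoning

  b+N≤g : b + N ≤ g
  b+N≤g = ≤-trans (m≤m+n (b + N) 2) room

  g+g≡2g : g + g ≡ 2 * g
  g+g≡2g = cong (g +_) (sym (+-identityʳ g))

  within-2g : ∀ {m} → m ≤ b + N → g + m ≤ 2 * g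
  within-2g {m} m≤ = begin
    g + m ≤⟨ +-monoʳ-≤ g (≤-trans m≤ b+N≤g) ⟩
    g + g ≡⟨ g+g≡2g ⟩
    2 * g ∎

  -- P₁ followed by q has N + 1 arcs, fewer than g ...
  spine-short : suc N < g
  spine-short = begin-strict
    suc N        <⟨ n<1+n (suc N) ⟩
    2 + N        ≡⟨ +-comm 2 N ⟩
    N + 2        ≤⟨ +-monoˡ-≤ 2 (m≤n+m N b) ⟩
    b + N + 2    ≤⟨ room ⟩
    g            ∎

  -- ... and so has a chain of b arcs followed by P₁ and q.
  extended-short : b + suc N < g
  extended-short = ≤-trans (≤-reflexive (shift b N)) room
    where
      shift : ∀ b N → suc (b + suc N) ≡ b + N + 2
      shift = solve-∀

  -- Type-I gadget from a walk q ⇝ p returned by the first chain.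
  first-typeI : ∀ W → suc (suc W) ≤ g + N → suc W ≤ 2 * g
  first-typeI W bound = ≤-trans (n≤1+n (suc W)) (≤-trans bound (within-2g (m≤n+m N b)))

  -- Size of an extended gadget whose P₂ (with Y arcs) comes from a walk of
  -- W arcs returned by the second chain.
  second-extension : ∀ {Y C W} → Y ≤ C → C < W → suc (suc W) ≤ g + b → suc (suc (N + suc Y)) ≤ 2 * g
  second-extension {Y} {C} {W} Y≤C C<W bound = begin
    suc (suc (N + suc Y)) ≤⟨ s≤s (s≤s (+-monoʳ-≤ N (≤-trans (s≤s Y≤C) C<W))) ⟩
    suc (suc (N + W))     ≡⟨ shift N W ⟩
    N + suc (suc W)       ≤⟨ +-monoʳ-≤ N bound ⟩
    N + (g + b)           ≡⟨ swap N g b ⟩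
    g + (b + N)           ≤⟨ within-2g ≤-refl ⟩
    2 * g                 ∎
    where
      shift : ∀ N W → suc (suc (N + W)) ≡ N + suc (suc W)
      shift = solve-∀
      swap : ∀ N g b → N + (g + b) ≡ g + (b + N)
      swap = solve-∀

  -- Type-I gadget from the part c ⇝ r (C arcs) of such a walk, followed by P₁.
  second-typeI : ∀ {C W} → C < W → suc (suc W) ≤ g + b → suc (suc (C + N)) ≤ 2 * g
  second-typeI {C} C<W bound =
    ≤-trans (s≤s (s≤s (≤-trans (≤-reflexive (+-comm C N)) (+-monoʳ-≤ N (n≤1+n C)))))
            (second-extension ≤-refl C<W bound)

  -- Size of an extended gadget whose P₂ is a complete second chain.
  chain-extension : suc (suc (N + suc b)) ≤ 2 * g
  chain-extension = begin
    suc (suc (N + suc b)) ≡⟨ shift N b ⟩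
    (b + N + 2) + 1       ≤⟨ +-mono-≤ room 1≤g ⟩
    g + g                 ≡⟨ g+g≡2g ⟩
    2 * g                 ∎
    where
      shift : ∀ N b → suc (suc (N + suc b)) ≡ (b + N + 2) + 1
      shift = solve-∀
      1≤g : 1 ≤ g
      1≤g = ≤-trans (s≤s z≤n) (≤-trans (m≤n+m 2 (b + N)) room)

  -- A closed walk through y → P₂ → P₁ with g ≤ Y + A + 2 arcs, where the part
  -- of P₁ has A < N arcs, forces P₂ to have Y ≥ b arcs.
  extension-long : ∀ {Y A} → g ≤ suc (suc (Y + A)) → suc A ≤ N → b ≤ Y
  extension-long {Y} {A} girth-bound A<N = +-cancelˡ-≤ N b Y (<⇒≤ (s≤s⁻¹ squeezed))
    where
      shift₁ : ∀ N b → suc (suc (N + b)) ≡ b + N + 2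
      shift₁ = solve-∀
      shift₂ : ∀ Y A → suc (suc (Y + A)) ≡ suc (Y + suc A)
      shift₂ = solve-∀
      squeezed : suc (suc (N + b)) ≤ suc (N + Y)
      squeezed = begin
        suc (suc (N + b))  ≡⟨ shift₁ N b ⟩
        b + N + 2          ≤⟨ room ⟩
        g                  ≤⟨ girth-bound ⟩
        suc (suc (Y + A))  ≡⟨ shift₂ Y A ⟩
        suc (Y + suc A)    ≤⟨ s≤s (+-monoʳ-≤ Y A<N) ⟩
        suc (Y + N)        ≡⟨ cong suc (+-comm Y N) ⟩
        suc (N + Y)        ∎

module Construction (D : Digraph) (g : ℕ) (girth : GirthAtLeast D g) (hyp : CycleOrCommonInNeighbour D g)
                    (b N : ℕ) (N-large : 2 * b * b + b ∸ 2 ≤ N) (N-pos : 1 ≤ N) (room : b + N + 2 ≤ g) where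

  open Girth D g girth
  open Chains D g hyp
  open Bounds b N g room
  open Shortcut (_≟_ {Digraph.n D}) (Arc D)

  Gadget : V D → V D → Set
  Gadget p q = TypeIGadget D g p q (2 * g) ⊎ ExtTypeIIGadget D b p q (2 * g)

  -- A complete first chain: the path P₁ = r ∷ s ∷ rest of a basic type-II
  -- gadget, all of whose vertices are in-neighbours of q.
  record Spine (p q : V D) : Set where
    field
      r s          : V D
      rest         : List (V D)
      dominates    : Dominating q p r (s ∷ rest)
      spine-length : length (s ∷ rest) ≡ N

  module FromSpine {p q : V D} (pq : Arc D p q) (σ : Spine p q) where

    open Spine σ
    open Dominating dominates
    open import Data.List.Membership.DecPropositional (_≟_ {Digraph.n D}) using (_∈?_)

    tl : List (V D)
    tl = s ∷ rest

    -- P₁ followed by the arc p → q has N + 1 arcs, hence is a path.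
    P₁q-linked : Linked (Arc D) (r ∷ tl ++ q ∷ [])
    P₁q-linked = linked-++ tl walk (subst (λ v → Linked (Arc D) (v ∷ q ∷ [])) (sym ends) (pq ∷ [-]))

    P₁q-unique : Unique (r ∷ tl ++ q ∷ [])
    P₁q-unique = short-walk-unique r (tl ++ q ∷ [])
      (subst (_< g) (sym (trans (length-∷ʳ tl q) (cong suc spine-length))) spine-short) P₁q-linked

    q∉P₁ : q ∉ r ∷ tl
    q∉P₁ q∈ = unique-disjoint (r ∷ tl) P₁q-unique q∈ (here refl)

    -- The vertices a path P₂ must avoid: q and V(P₁) ∖ {r}.
    Blocked : V D → Set
    Blocked v = v ≡ q ⊎ v ∈ tl

    blocked? : ∀ v → Dec (Blocked v)
    blocked? v = (v ≟ q) ⊎-dec (v ∈? tl)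

    open LastExit {R = Arc D} Blocked blocked? using (exit; lastExit)

    r-free : ¬ Blocked r
    r-free (inj₁ r≡q)  = q∉P₁ (here (sym r≡q))
    r-free (inj₂ r∈tl) = unique-disjoint (r ∷ []) P₁q-unique (here refl) (∈-++⁺ˡ r∈tl)

    extended : ∀ w us → Unique (w ∷ us) → Linked (Arc D) (w ∷ us) → end w us ≡ r → b ≤ length us →
               (∀ {v} → v ∈ w ∷ us → ¬ Blocked v) → Arc D w s ⊎ (∃[ v ] (v ∈ tl × Arc D v w)) →
               suc (suc (N + suc (length us))) ≤ 2 * g → Gadget p q
    extended w us u l e long avoid joined size =
      inj₂ (r , r ∷ tl , w ∷ us ,
            (unique-prefix (r ∷ tl) P₁q-unique , walk) , refl , trans (last≡end r tl) (cong just ends) ,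
            subst (_ ≤_) (sym spine-length) N-large , q∉P₁ , into ,
            (u , l) , trans (last≡end w us) (cong just e) , long , meet , (λ q∈ → avoid q∈ (inj₁ refl)) ,
            join joined ,
            ≤-trans (length-deduplicate _≟_ (q ∷ (r ∷ tl) ++ w ∷ us)) (subst (_≤ 2 * g) (sym vertex-count) size))
      where
        meet : ∀ v → v ∈ r ∷ tl → v ∈ w ∷ us → v ≡ r
        meet v (here v≡r)   _    = v≡r
        meet v (there v∈tl) v∈P₂ = ⊥-elim (avoid v∈P₂ (inj₂ v∈tl))
        join : Arc D w s ⊎ (∃[ v ] (v ∈ tl × Arc D v w)) →
               (∃[ w′ ] ∃[ s′ ] ∃[ rest′ ] (just w ≡ just w′ × r ∷ tl ≡ r ∷ s′ ∷ rest′ × Arc D w′ s′))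
               ⊎ (∃[ w′ ] ∃[ v ] (just w ≡ just w′ × v ∈ r ∷ tl × v ≢ r × Arc D v w′))
        join (inj₁ ws)             = inj₁ (w , s , rest , refl , refl , ws)
        join (inj₂ (v , v∈tl , vw)) =
          inj₂ (w , v , refl , there v∈tl , (λ v≡r → r-free (inj₂ (subst (_∈ tl) v≡r v∈tl))) , vw)
        vertex-count : length (q ∷ (r ∷ tl) ++ w ∷ us) ≡ suc (suc (N + suc (length us)))
        vertex-count = cong (λ t → suc (suc t))
                            (trans (length-++ tl) (cong (_+ suc (length us)) spine-length))

    -- A complete second chain w ⇝ r of in-neighbours of s is the path P₂:
    -- together with P₁ and q it is a walk shorter than g, hence a path.
    via-chain : ∀ w us → Dominating s r w us → length us ≡ b → Gadget p q
    via-chain w us (dominating l e into-s) len =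
      extended w us (unique-prefix (w ∷ us) u) l e (≤-reflexive (sym len)) avoid (inj₁ (All.head into-s))
               (subst (λ k → suc (suc (N + suc k)) ≤ 2 * g) (sym len) chain-extension)
      where
        whole : Linked (Arc D) (w ∷ us ++ tl ++ q ∷ [])
        whole = linked-++ us l (subst (λ v → Linked (Arc D) (v ∷ tl ++ q ∷ [])) (sym e) P₁q-linked)
        whole-length : length (us ++ tl ++ q ∷ []) ≡ b + suc N
        whole-length = trans (length-++ us)
                             (cong₂ _+_ len (trans (length-∷ʳ tl q) (cong suc spine-length)))
        u : Unique (w ∷ us ++ tl ++ q ∷ [])
        u = short-walk-unique w (us ++ tl ++ q ∷ []) (subst (_< g) (sym whole-length) extended-short) whole
        avoid : ∀ {v} → v ∈ w ∷ us → ¬ Blocked v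
        avoid v∈ (inj₁ v≡q)  = unique-disjoint (w ∷ us) u v∈ (∈-++⁺ʳ tl (here v≡q))
        avoid v∈ (inj₂ v∈tl) = unique-disjoint (w ∷ us) u v∈ (∈-++⁺ˡ v∈tl)

    -- The last exit is an arc q → c: then q → c ⇝ r followed by P₁ is a walk q ⇝ p.
    via-q : ∀ c cs → Arc D q c → Linked (Arc D) (c ∷ cs) → end c cs ≡ r →
            suc (suc (length cs + N)) ≤ 2 * g → Gadget p q
    via-q c cs qc l e bound =
      inj₁ (typeI-from-walk pq (c ∷ cs ++ tl) (qc ∷ linked-++ cs l (subst (λ v → Linked (Arc D) (v ∷ tl)) (sym e) walk))
                            (trans (end-++ c cs tl) (trans (cong (λ v → end v tl) e) ends))
                            (subst (_≤ 2 * g) (sym walk-length) bound))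
      where
        walk-length : suc (length (c ∷ cs ++ tl)) ≡ suc (suc (length cs + N))
        walk-length = cong (λ t → suc (suc t)) (trans (length-++ cs) (cong (length cs +_) spine-length))

    -- The last exit is an arc y → c with y on P₁ ∖ {r}: the shortcut of
    -- c ⇝ r is P₂, and it is long because P₁ up to y, then y → P₂, closes
    -- a walk which girth forces to have at least g arcs.
    via-spine : ∀ y c cs {W} → y ∈ tl → Arc D y c → Linked (Arc D) (c ∷ cs) → end c cs ≡ r →
                All (λ v → ¬ Blocked v) (c ∷ cs) → length cs < W → suc (suc W) ≤ g + b → Gadget p q
    via-spine y c cs y∈tl yc l e avoid C<W bound with ∈-∃++ y∈tl
    ... | as , bs , split =
      extended c vertices unique linked c⇝r long (λ v∈ → All.lookup avoid (sub v∈)) (inj₂ (y , y∈tl , yc))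
               (second-extension shorter C<W bound)
      where
        open PathIn (shortcut c cs l)
        c⇝r : end c vertices ≡ r
        c⇝r = trans same-end e
        before-y : Linked (Arc D) (r ∷ as) × Arc D (end r as) y
        before-y = linked-prefix as (subst (λ L → Linked (Arc D) (r ∷ L)) split walk)
        loop : Linked (Arc D) (y ∷ c ∷ vertices ++ as)
        loop = yc ∷ linked-++ vertices linked (subst (λ v → Linked (Arc D) (v ∷ as)) (sym c⇝r) (proj₁ before-y))
        loop-closes : Arc D (end y (c ∷ vertices ++ as)) y
        loop-closes = subst (λ v → Arc D v y)
                            (sym (trans (end-++ c vertices as) (cong (λ v → end v as) c⇝r))) (proj₂ before-y)
        loop-long : g ≤ suc (suc (length vertices + length as))
        loop-long = subst (λ t → g ≤ suc (suc t)) (length-++ vertices)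
                          (closed-walk-long y (c ∷ vertices ++ as) loop loop-closes)
        as-short : suc (length as) ≤ N
        as-short = subst (suc (length as) ≤_)
                         (trans (sym (length-split as y bs)) (trans (cong length (sym split)) spine-length))
                         (s≤s (m≤m+n (length as) (length bs)))
        long : b ≤ length vertices
        long = extension-long loop-long as-short

    -- The second chain returned a walk s ⇝ r: it starts blocked and ends
    -- free, so consider its last exit from the blocked vertices.
    via-return : ∀ ws → Linked (Arc D) (s ∷ ws) → end s ws ≡ r → suc (suc (length ws)) ≤ g + b → Gadget p q
    via-return ws l e bound with lastExit s ws l (inj₂ (here refl))
                                                  (subst (λ v → ¬ Blocked v) (sym e) r-free)
    ... | exit y c cs (inj₁ refl) qc lc ec _ short =
      via-q c cs qc lc (trans ec e) (second-typeI short bound)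
    ... | exit y c cs (inj₂ y∈tl) yc lc ec avoid short =
      via-spine y c cs y∈tl yc lc (trans ec e) avoid short bound

    from-spine : Gadget p q
    from-spine with chain s r (Linked.head walk) b
    ... | complete w us d len  = via-chain w us d len
    ... | returns ws l e bound = via-return ws l e bound

  gadget : ∀ p q → Arc D p q → Gadget p q
  gadget p q pq with chain q p pq N
  ... | returns ws l e bound = inj₁ (typeI-from-walk pq ws l e (first-typeI (length ws) bound))
  ... | complete r (s ∷ rest) d len =
    FromSpine.from-spine pq (record { r = r ; s = s ; rest = rest ; dominates = d ; spine-length = len })
  ... | complete r [] _ len with subst (1 ≤_) (sym len) N-pos
  ...   | ()

spine-length-value : ∀ c → 2 * suc c * suc c + suc c ∸ 2 ≡ 2 * c * c + 5 * c + 1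
spine-length-value c = cong (_∸ 2) (expand c)
  where
    expand : ∀ c → 2 * suc c * suc c + suc c ≡ 2 + (2 * c * c + 5 * c + 1)
    expand = solve-∀

spine-room : ∀ c → suc c + (2 * suc c * suc c + suc c ∸ 2) + 2 ≤ 4 * suc c * suc c
spine-room c = subst (λ N → suc c + N + 2 ≤ 4 * suc c * suc c) (sym (spine-length-value c))
                     (≤-trans (m≤m+n _ (2 * c * c + 2 * c)) (≤-reflexive (sym (expand c))))
  where
    expand : ∀ c → 4 * suc c * suc c ≡ (suc c + (2 * c * c + 5 * c + 1) + 2) + (2 * c * c + 2 * c)
    expand = solve-∀

lemma2p10 : (b : ℕ) → 1 ≤ b → (D : Digraph) →
    GirthAtLeast D (4 * b * b) →
    (∀ x y → Arc D x y →
      CycleThrough D x y (λ cs → length cs ≡ 4 * b * b)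
      ⊎ (∃[ z ] (z ≢ x × z ≢ y × Arc D z x × Arc D z y))) →
    ∀ p q → Arc D p q →
      TypeIGadget D (4 * b * b) p q (2 * (4 * b * b))
      ⊎ ExtTypeIIGadget D b p q (2 * (4 * b * b))
lemma2p10 (suc c) (s≤s z≤n) D girth hyp =
  Construction.gadget D (4 * suc c * suc c) girth hyp (suc c) (2 * suc c * suc c + suc c ∸ 2)
                      ≤-refl N-pos (spine-room c)
  where
    N-pos : 1 ≤ 2 * suc c * suc c + suc c ∸ 2
    N-pos = subst (1 ≤_) (sym (spine-length-value c)) (m≤n+m 1 (2 * c * c + 5 * c))
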